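{- Let $f$ be a satisfiable phylogenetic payoff function of arity $k$ and let $P$ be a pattern with payoff $1$ for $f$, whose leaves labelled $x_1,\dots,x_k$ appear in this left-to-right order in $P$. Let $\mathcal{I}$ be an instance of the phylogenetic CSP with payoff function $f$ on variable set $V$, and let $\psi$ be an injective map from $V$ to the leaves of a rooted ordered tree $T$ in which every internal node has exactly $k$ children. Then there exists a tree $T'$ (rooted, ordered, binary) with the same set of leaves as $T$ such that for every constraint $f(y_1,\dots,y_k)$ of $\mathcal{I}$ for which $\psi(y_1),\dots,\psi(y_k)$ are cousins in $T$, we have $f(y_1,\dots,y_k)=1$ when the variables are placed at the leaves of $T'$ according to $\psi$.
   Context: Binary trees here are finite rooted trees in which every internal node has exactly two children ordered as left and right; leaves are ordered left to right. A pattern on $x_1,\dots,x_k$ is such a tree with $k$ leaves bijectively labelled by $x_1,\dots,x_k$; distinct variables injectively placed at leaves of a binary tree match $P$ if $P$ is obtained by deleting unassigned leaves and contracting nodes with one child (preserving labels and order). A payoff function $f$ of arity $k$ assigns a payoff in $[0,1]$ to each pattern; $f(y_1,\dots,y_k)$ is the payoff of the pattern matched by $y_1,\dots,y_k$ (the $i$-th argument in the role of $x_i$); $f$ is satisfiable if its maximum payoff is $1$. An instance consists of variables $V$ and a probability distribution over constraints $f(y_1,\dots,y_k)$ on distinct variables. Cousins: leaves $l_1,\dots,l_k$ of a tree in which every internal node has $k$ ordered children are cousins if, letting $u=\mathrm{lca}(l_1,\dots,l_k)$ and $u_1,\dots,u_k$ its children from left to right, each $l_i$ lies in the subtree rooted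 at $u_i$. -}

module Defs where

open import Data.Nat using (ℕ; zero; suc)
open import Data.Nat.Properties using () renaming (_≟_ to _≟ℕ_)
open import Data.Fin using (Fin; zero; suc)
open import Data.Vec using (Vec; []; _∷_; lookup)
open import Data.List using (List; []; _∷_; _++_; allFin; foldr; map)
open import Data.List.Membership.Propositional using (_∈_)
open import Data.List.Relation.Unary.All using (All)
open import Data.List.Relation.Binary.Permutation.Propositional using (_↭_)
open import Data.Maybe using (Maybe; just; nothing)
open import Data.Product using (Σ; ∃; _×_; _,_; proj₁; proj₂)
open import Data.Sum using (_⊎_)
open import Data.Empty using (⊥)
open import Data.Rational using (ℚ; 0ℚ; 1ℚ; _+_; _≤_; _<_)
open import Relation.Binary.PropositionalEquality using (_≡_; _≢_)
open import Relation.Nullary using (¬_; yes; no)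
open import Function.Definitions using (Injective)

data BTree (L : Set) : Set where
  leaf : L → BTree L
  node : BTree L → BTree L → BTree L

bleaves : ∀ {L} → BTree L → List L
bleaves (leaf l)   = l ∷ []
bleaves (node a b) = bleaves a ++ bleaves b

-- A pattern on x₁,…,x_k (x_i represented by i : Fin k): a binary tree whose
-- leaves are labelled bijectively by Fin k.
IsPattern : (k : ℕ) → BTree (Fin k) → Set
IsPattern k t = bleaves t ↭ allFin k

restrict : ∀ {L M : Set} → (L → Maybe M) → BTree L → Maybe (BTree M)
restrict g (leaf l) with g l
... | just m  = just (leaf m)
... | nothing = nothing
restrict g (node a b) with restrict g a | restrict g b
... | just a' | just b'  = just (node a' b')
... | just a' | nothing  = just a'
... | nothing | just b'  = just b'
... | nothing | nothing  = nothing

-- index i with ψ i ≡ l (first one; unique when ψ is injective)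
findIndex : ∀ {k} → (Fin k → ℕ) → ℕ → Maybe (Fin k)
findIndex {zero}  ψ l = nothing
findIndex {suc k} ψ l with ψ zero ≟ℕ l
... | yes _ = just zero
... | no  _ with findIndex {k} (λ i → ψ (suc i)) l
...   | just i  = just (suc i)
...   | nothing = nothing

-- The pattern matched by the leaves p(1),…,p(k) (leaf labels ℕ) of T;
-- the i-th leaf plays the role of x_i.
matched : ∀ {k} → BTree ℕ → (Fin k → ℕ) → Maybe (BTree (Fin k))
matched T p = restrict (findIndex p) T

-- Payoff functions: payoff in [0,1] for each pattern (values on non-pattern
-- trees are irrelevant).

PayoffFunction : ℕ → Set
PayoffFunction k = BTree (Fin k) → ℚ

IsPayoffFunction : (k : ℕ) → PayoffFunction k → Set
IsPayoffFunction k f = ∀ t → IsPattern k t → (0ℚ ≤ f t) × (f t ≤ 1ℚ)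

Satisfiable : (k : ℕ) → PayoffFunction k → Set
Satisfiable k f = Σ (BTree (Fin k)) λ t → IsPattern k t × f t ≡ 1ℚ

-- Instances on variable set V = Fin n: a finitely supported probability
-- distribution over constraints f(y₁,…,y_k), y a vector of distinct variables.

record Instance (n k : ℕ) : Set where
  field
    constraints : List (Vec (Fin n) k × ℚ)       -- (scope , probability)
    distinct    : All (λ c → ∀ i j → lookup (proj₁ c) i ≡ lookup (proj₁ c) j → i ≡ j) constraints
    positive    : All (λ c → 0ℚ < proj₂ c) constraints
    total       : foldr (λ c s → proj₂ c + s) 0ℚ constraints ≡ 1ℚ

IsConstraint : ∀ {n k} → Instance n k → Vec (Fin n) k → Set
IsConstraint I y = ∃ λ w → (y , w) ∈ Instance.constraints I

data KTree (k : ℕ) : Set where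
  leaf : ℕ → KTree k
  node : Vec (KTree k) k → KTree k

mutual
  kleaves : ∀ {k} → KTree k → List ℕ
  kleaves (leaf l)  = l ∷ []
  kleaves (node ts) = kleavesV ts

  kleavesV : ∀ {k m} → Vec (KTree k) m → List ℕ
  kleavesV []       = []
  kleavesV (t ∷ ts) = kleaves t ++ kleavesV ts

-- u = node ts is the lca of l₁,…,l_k and each l_i lies below the i-th child:
-- each l_i is in the subtree of the i-th child (so all are below u), and no
-- single child contains all of them (so u is the lowest common ancestor).
CousinsAt : ∀ {k} → Vec (KTree k) k → (Fin k → ℕ) → Set
CousinsAt {k} ts l =
  (∀ i → l i ∈ kleaves (lookup ts i)) ×
  ¬ (Σ (Fin k) λ j → ∀ i → l i ∈ kleaves (lookup ts j))

mutual
  Cousins : ∀ {k} → KTree k → (Fin k → ℕ) → Set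
  Cousins (leaf _)  l = ⊥
  Cousins (node ts) l = CousinsAt ts l ⊎ CousinsV ts l

  CousinsV : ∀ {k m} → Vec (KTree k) m → (Fin k → ℕ) → Set
  CousinsV []       l = ⊥
  CousinsV (t ∷ ts) l = Cousins t l ⊎ CousinsV ts l

-- Replace every internal node of T, with children t₁,…,t_k, by a copy of P whose
-- leaf x_i is replaced by the binarization of t_i.  If the leaves of a constraint
-- are cousins at the node u, each of them lies in the tree grafted at a
-- different leaf of the copy of P made for u, so restricting to them gives back P;
-- the nodes above u only graft the copy of u into a position where nothing else
-- is kept, so they do not change the restriction.
module Submission where

open import Defs
open import Data.Nat using (ℕ; suc)
open import Data.Nat.Properties using (_≟_)
open import Data.Fin using (Fin; zero; suc)
open import Data.Fin.Properties using (suc-injective)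
open import Data.Vec using (Vec; lookup; []; _∷_)
open import Data.List using (List; []; _∷_; _++_; allFin; tabulate; concat; concatMap)
open import Data.List.Properties using (++-identityʳ; concatMap-++; map-tabulate; tabulate-cong)
open import Data.List.Membership.Propositional using (_∈_)
open import Data.List.Membership.Propositional.Properties using (∈-++⁺ˡ; ∈-++⁺ʳ; ∈-++⁻; ∈-allFin)
open import Data.List.Relation.Unary.Any using (here; there)
import Data.List.Relation.Unary.All as All
import Data.List.Relation.Unary.All.Properties as All
open import Data.List.Relation.Unary.AllPairs using ([]; _∷_)
open import Data.List.Relation.Unary.Unique.Propositional using (Unique)
open import Data.List.Relation.Unary.Unique.Propositional.Properties using (allFin⁺)
open import Data.List.Relation.Binary.Disjoint.Propositional using (Disjoint)
open import Data.List.Relation.Binary.Permutation.Propositional using (_↭_; ↭-reflexive)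
open import Data.Maybe using (Maybe; just; nothing)
import Data.Maybe as Maybe
open import Data.Product using (Σ; _×_; _,_)
open import Data.Sum using (inj₁; inj₂)
open import Data.Rational using (1ℚ)
open import Function using (_∘_; id)
open import Relation.Binary.PropositionalEquality
  using (_≡_; _≢_; refl; sym; trans; cong; cong₂; subst; module ≡-Reasoning)
open import Relation.Nullary using (yes; no; contradiction)
open import Function.Definitions using (Injective)

Unique-++⁻ˡ : ∀ {A : Set} (xs : List A) {ys} → Unique (xs ++ ys) → Unique xs
Unique-++⁻ˡ []       _          = []
Unique-++⁻ˡ (x ∷ xs) (x∉ ∷ xs!) = All.++⁻ˡ xs x∉ ∷ Unique-++⁻ˡ xs xs!

Unique-++⁻ʳ : ∀ {A : Set} (xs : List A) {ys} → Unique (xs ++ ys) → Unique ys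
Unique-++⁻ʳ []       ys!       = ys!
Unique-++⁻ʳ (x ∷ xs) (_ ∷ xs!) = Unique-++⁻ʳ xs xs!

Unique-++⇒Disjoint : ∀ {A : Set} (xs : List A) {ys} → Unique (xs ++ ys) → Disjoint xs ys
Unique-++⇒Disjoint (x ∷ xs) (x∉ ∷ _)   (here refl , v∈ys) = All.lookup (All.++⁻ʳ xs x∉) v∈ys refl
Unique-++⇒Disjoint (x ∷ xs) (_ ∷ xs!) (there v∈xs , v∈ys) = Unique-++⇒Disjoint xs xs! (v∈xs , v∈ys)

findIndex-sound : ∀ {k} (p : Fin k → ℕ) {x i} → findIndex p x ≡ just i → p i ≡ x
findIndex-sound {suc k} p {x} eq with p zero ≟ x
findIndex-sound {suc k} p refl | yes p0≡x = p0≡x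
... | no _ with findIndex (λ j → p (suc j)) x in eq′
findIndex-sound {suc k} p refl | no _ | just j = findIndex-sound (λ j → p (suc j)) eq′

findIndex-inverse : ∀ {k} (p : Fin k → ℕ) → Injective _≡_ _≡_ p → ∀ i → findIndex p (p i) ≡ just i
findIndex-inverse {suc k} p p-injective zero with p zero ≟ p zero
... | yes _      = refl
... | no p0≢p0   = contradiction refl p0≢p0
findIndex-inverse {suc k} p p-injective (suc i) with p zero ≟ p (suc i)
... | yes p0≡pi = contradiction (p-injective p0≡pi) λ ()
... | no _ rewrite findIndex-inverse (λ j → p (suc j)) (λ e → suc-injective (p-injective e)) i = refl

findIndex-nothing : ∀ {k} (p : Fin k → ℕ) {x} → (∀ i → p i ≢ x) → findIndex p x ≡ nothing
findIndex-nothing p {x} x∉p with findIndex p x in eq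
... | nothing = refl
... | just i  = contradiction (findIndex-sound p eq) (x∉p i)

merge : ∀ {A : Set} → Maybe (BTree A) → Maybe (BTree A) → Maybe (BTree A)
merge (just a) (just b) = just (node a b)
merge (just a) nothing  = just a
merge nothing  r        = r

module _ {L M : Set} (g : L → Maybe M) where

  restrict-node : ∀ a b → restrict g (node a b) ≡ merge (restrict g a) (restrict g b)
  restrict-node a b with restrict g a | restrict g b
  ... | just _  | just _  = refl
  ... | just _  | nothing = refl
  ... | nothing | just _  = refl
  ... | nothing | nothing = refl

  restrict-none : ∀ S → (∀ {y} → y ∈ bleaves S → g y ≡ nothing) → restrict g S ≡ nothing
  restrict-none (leaf y) g≡nothing rewrite g≡nothing (here refl) = refl
  restrict-none (node a b) g≡nothing = trans (restrict-node a b)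
    (cong₂ merge (restrict-none a (g≡nothing ∘ ∈-++⁺ˡ))
                 (restrict-none b (g≡nothing ∘ ∈-++⁺ʳ (bleaves a))))

  restrict-single : ∀ S {x m} → Unique (bleaves S) → x ∈ bleaves S → g x ≡ just m →
                    (∀ {y} → y ∈ bleaves S → y ≢ x → g y ≡ nothing) →
                    restrict g S ≡ just (leaf m)
  restrict-single (leaf y) _ (here refl) g≡m _ rewrite g≡m = refl
  restrict-single (node a b) S! x∈S g≡m others with ∈-++⁻ (bleaves a) x∈S
  ... | inj₁ x∈a = trans (restrict-node a b) (cong₂ merge
          (restrict-single a (Unique-++⁻ˡ (bleaves a) S!) x∈a g≡m (others ∘ ∈-++⁺ˡ))
          (restrict-none b λ y∈b → others (∈-++⁺ʳ (bleaves a) y∈b)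
            λ { refl → Unique-++⇒Disjoint (bleaves a) S! (x∈a , y∈b) }))
  ... | inj₂ x∈b = trans (restrict-node a b) (cong₂ merge
          (restrict-none a λ y∈a → others (∈-++⁺ˡ y∈a)
            λ { refl → Unique-++⇒Disjoint (bleaves a) S! (y∈a , x∈b) })
          (restrict-single b (Unique-++⁻ʳ (bleaves a) S!) x∈b g≡m (others ∘ ∈-++⁺ʳ (bleaves a))))

graft : ∀ {A B : Set} → BTree A → (A → BTree B) → BTree B
graft (leaf a)   σ = σ a
graft (node l r) σ = node (graft l σ) (graft r σ)

join : ∀ {A : Set} → BTree (BTree A) → BTree A
join t = graft t id

bleaves-graft : ∀ {A B : Set} (Q : BTree A) (σ : A → BTree B) →
                bleaves (graft Q σ) ≡ concatMap (bleaves ∘ σ) (bleaves Q)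
bleaves-graft (leaf a)   σ = sym (++-identityʳ (bleaves (σ a)))
bleaves-graft (node l r) σ = trans (cong₂ _++_ (bleaves-graft l σ) (bleaves-graft r σ))
                                   (sym (concatMap-++ (bleaves ∘ σ) (bleaves l) (bleaves r)))

map-join-merge : ∀ {A : Set} (s t : Maybe (BTree (BTree A))) →
                 Maybe.map join (merge s t) ≡ merge (Maybe.map join s) (Maybe.map join t)
map-join-merge (just _) (just _) = refl
map-join-merge (just _) nothing  = refl
map-join-merge nothing  _        = refl

restrict-graft : ∀ {A L M : Set} (g : L → Maybe M) (σ : A → BTree L) Q →
                 restrict g (graft Q σ) ≡ Maybe.map join (restrict (restrict g ∘ σ) Q)
restrict-graft g σ (leaf a) with restrict g (σ a)
... | just _  = refl
... | nothing = refl
restrict-graft g σ (node l r) = begin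
  restrict g (graft (node l r) σ)
    ≡⟨ restrict-node g (graft l σ) (graft r σ) ⟩
  merge (restrict g (graft l σ)) (restrict g (graft r σ))
    ≡⟨ cong₂ merge (restrict-graft g σ l) (restrict-graft g σ r) ⟩
  merge (Maybe.map join (restrict h l)) (Maybe.map join (restrict h r))
    ≡⟨ map-join-merge (restrict h l) (restrict h r) ⟨
  Maybe.map join (merge (restrict h l) (restrict h r))
    ≡⟨ cong (Maybe.map join) (restrict-node h l r) ⟨
  Maybe.map join (restrict h (node l r)) ∎
  where
  open ≡-Reasoning
  h = restrict g ∘ σ

restrict-graft-leaves : ∀ {A L : Set} (g : L → Maybe A) (σ : A → BTree L) →
                        (∀ a → restrict g (σ a) ≡ just (leaf a)) →
                        ∀ Q → restrict g (graft Q σ) ≡ just Q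
restrict-graft-leaves g σ σ↦leaf (leaf a)   = σ↦leaf a
restrict-graft-leaves g σ σ↦leaf (node l r) = trans (restrict-node g (graft l σ) (graft r σ))
  (cong₂ merge (restrict-graft-leaves g σ σ↦leaf l) (restrict-graft-leaves g σ σ↦leaf r))

module _ {k : ℕ} where

  ∈-kleavesV⁺ : ∀ {m} (ts : Vec (KTree k) m) i {x} → x ∈ kleaves (lookup ts i) → x ∈ kleavesV ts
  ∈-kleavesV⁺ (t ∷ ts) zero    x∈t = ∈-++⁺ˡ x∈t
  ∈-kleavesV⁺ (t ∷ ts) (suc i) x∈t = ∈-++⁺ʳ (kleaves t) (∈-kleavesV⁺ ts i x∈t)

  Unique-kleaves-lookup : ∀ {m} (ts : Vec (KTree k) m) → Unique (kleavesV ts) →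
                          ∀ i → Unique (kleaves (lookup ts i))
  Unique-kleaves-lookup (t ∷ ts) ts! zero    = Unique-++⁻ˡ (kleaves t) ts!
  Unique-kleaves-lookup (t ∷ ts) ts! (suc i) = Unique-kleaves-lookup ts (Unique-++⁻ʳ (kleaves t) ts!) i

  kleaves-lookup-disjoint : ∀ {m} (ts : Vec (KTree k) m) → Unique (kleavesV ts) → ∀ {i j x} →
                            x ∈ kleaves (lookup ts i) → x ∈ kleaves (lookup ts j) → i ≡ j
  kleaves-lookup-disjoint (t ∷ ts) ts! {zero}  {zero}  _ _ = refl
  kleaves-lookup-disjoint (t ∷ ts) ts! {zero}  {suc j} x∈t x∈ts =
    contradiction (x∈t , ∈-kleavesV⁺ ts j x∈ts) (Unique-++⇒Disjoint (kleaves t) ts!)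
  kleaves-lookup-disjoint (t ∷ ts) ts! {suc i} {zero}  x∈ts x∈t =
    contradiction (x∈t , ∈-kleavesV⁺ ts i x∈ts) (Unique-++⇒Disjoint (kleaves t) ts!)
  kleaves-lookup-disjoint (t ∷ ts) ts! {suc i} {suc j} x∈i x∈j =
    cong suc (kleaves-lookup-disjoint ts (Unique-++⁻ʳ (kleaves t) ts!) x∈i x∈j)

  kleavesV-tabulate : ∀ {m} (ts : Vec (KTree k) m) → kleavesV ts ≡ concat (tabulate (kleaves ∘ lookup ts))
  kleavesV-tabulate []       = refl
  kleavesV-tabulate (t ∷ ts) = cong (kleaves t ++_) (kleavesV-tabulate ts)

  mutual
    Cousins⇒∈ : ∀ T {l : Fin k → ℕ} → Cousins T l → ∀ i → l i ∈ kleaves T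
    Cousins⇒∈ (node ts) (inj₁ (l∈ , _)) i = ∈-kleavesV⁺ ts i (l∈ i)
    Cousins⇒∈ (node ts) (inj₂ below)    i = CousinsV⇒∈ ts below i

    CousinsV⇒∈ : ∀ {m} (ts : Vec (KTree k) m) {l : Fin k → ℕ} → CousinsV ts l → ∀ i → l i ∈ kleavesV ts
    CousinsV⇒∈ (t ∷ ts) (inj₁ c) i = ∈-++⁺ˡ (Cousins⇒∈ t c i)
    CousinsV⇒∈ (t ∷ ts) (inj₂ c) i = ∈-++⁺ʳ (kleaves t) (CousinsV⇒∈ ts c i)

module Binarization {k : ℕ} (P : BTree (Fin k)) (P-leaves : bleaves P ≡ allFin k) where

  mutual
    binarize : KTree k → BTree ℕ
    binarize (leaf l)  = leaf l
    binarize (node ts) = graft P (binarizeChild ts)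

    binarizeChild : ∀ {m} → Vec (KTree k) m → Fin m → BTree ℕ
    binarizeChild (t ∷ ts) zero    = binarize t
    binarizeChild (t ∷ ts) (suc i) = binarizeChild ts i

  mutual
    bleaves-binarize : ∀ T → bleaves (binarize T) ≡ kleaves T
    bleaves-binarize (leaf l)  = refl
    bleaves-binarize (node ts) = begin
      bleaves (graft P σ)                           ≡⟨ bleaves-graft P σ ⟩
      concatMap (bleaves ∘ σ) (bleaves P)           ≡⟨ cong (concatMap (bleaves ∘ σ)) P-leaves ⟩
      concatMap (bleaves ∘ σ) (tabulate id)         ≡⟨ cong concat (map-tabulate id (bleaves ∘ σ)) ⟩
      concat (tabulate (bleaves ∘ σ))               ≡⟨ cong concat (tabulate-cong (bleaves-binarizeChild ts)) ⟩
      concat (tabulate (kleaves ∘ lookup ts))       ≡⟨ kleavesV-tabulate ts ⟨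
      kleavesV ts                                   ∎
      where
      open ≡-Reasoning
      σ = binarizeChild ts

    bleaves-binarizeChild : ∀ {m} (ts : Vec (KTree k) m) i →
                            bleaves (binarizeChild ts i) ≡ kleaves (lookup ts i)
    bleaves-binarizeChild (t ∷ ts) zero    = bleaves-binarize t
    bleaves-binarizeChild (t ∷ ts) (suc i) = bleaves-binarizeChild ts i

  module _ (p : Fin k → ℕ) (p-injective : Injective _≡_ _≡_ p) where

    private
      ∈-binarizeChild⁻ : ∀ {m} (ts : Vec (KTree k) m) i {y} →
                 y ∈ bleaves (binarizeChild ts i) → y ∈ kleaves (lookup ts i)
      ∈-binarizeChild⁻ ts i = subst (_ ∈_) (bleaves-binarizeChild ts i)

    mutual
      matched-binarize : ∀ T → Unique (kleaves T) → Cousins T p → matched (binarize T) p ≡ just P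
      matched-binarize (node ts) ts! (inj₁ (p∈ , _)) =
        restrict-graft-leaves (findIndex p) σ σ↦leaf P
        where
        σ = binarizeChild ts

        σ↦leaf : ∀ i → matched (σ i) p ≡ just (leaf i)
        σ↦leaf i = restrict-single (findIndex p) (σ i)
          (subst Unique (sym (bleaves-binarizeChild ts i)) (Unique-kleaves-lookup ts ts! i))
          (subst (p i ∈_) (sym (bleaves-binarizeChild ts i)) (p∈ i))
          (findIndex-inverse p p-injective i)
          λ y∈σi y≢pi → findIndex-nothing p λ j pj≡y →
            y≢pi (trans (sym pj≡y) (cong p
              (kleaves-lookup-disjoint ts ts! (p∈ j) (subst (_∈ _) (sym pj≡y) (∈-binarizeChild⁻ ts i y∈σi)))))
      matched-binarize (node ts) ts! (inj₂ below) with matched-binarizeChild ts ts! below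
      ... | c , σc↦P , p∈c = begin
        restrict g (graft P σ)                       ≡⟨ restrict-graft g σ P ⟩
        Maybe.map join (restrict (restrict g ∘ σ) P)  ≡⟨ cong (Maybe.map join) σ↦P ⟩
        just P                                        ∎
        where
        open ≡-Reasoning
        g = findIndex p
        σ = binarizeChild ts

        σ↦P : restrict (restrict g ∘ σ) P ≡ just (leaf P)
        σ↦P = restrict-single (restrict g ∘ σ) P
          (subst Unique (sym P-leaves) (allFin⁺ k)) (subst (c ∈_) (sym P-leaves) (∈-allFin c)) σc↦P
          λ {j} _ j≢c → restrict-none g (σ j) λ y∈σj → findIndex-nothing p λ i pi≡y →
            j≢c (kleaves-lookup-disjoint ts ts! (subst (_∈ _) (sym pi≡y) (∈-binarizeChild⁻ ts j y∈σj)) (p∈c i))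

      matched-binarizeChild : ∀ {m} (ts : Vec (KTree k) m) → Unique (kleavesV ts) → CousinsV ts p →
                              Σ (Fin m) λ c → (matched (binarizeChild ts c) p ≡ just P) ×
                                              (∀ i → p i ∈ kleaves (lookup ts c))
      matched-binarizeChild (t ∷ ts) ts! (inj₁ c) =
        zero , matched-binarize t (Unique-++⁻ˡ (kleaves t) ts!) c , Cousins⇒∈ t c
      matched-binarizeChild (t ∷ ts) ts! (inj₂ c) with matched-binarizeChild ts (Unique-++⁻ʳ (kleaves t) ts!) c
      ... | c′ , matched≡P , p∈c′ = suc c′ , matched≡P , p∈c′

lemma4 : (k : ℕ) (f : PayoffFunction k) → IsPayoffFunction k f → Satisfiable k f →
    (P : BTree (Fin k)) → IsPattern k P → f P ≡ 1ℚ → bleaves P ≡ allFin k →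
    (n : ℕ) (I : Instance n k) (T : KTree k) → Unique (kleaves T) →
    (ψ : Fin n → ℕ) → Injective _≡_ _≡_ ψ → (∀ v → ψ v ∈ kleaves T) →
    Σ (BTree ℕ) λ T' → (bleaves T' ↭ kleaves T) ×
      (∀ (y : Vec (Fin n) k) → IsConstraint I y →
        Cousins T (λ i → ψ (lookup y i)) →
        Σ (BTree (Fin k)) λ Q →
          (matched T' (λ i → ψ (lookup y i)) ≡ just Q) × (f Q ≡ 1ℚ))
lemma4 _ _ _ _ P _ fP≡1 P-leaves _ I T T! ψ ψ-injective _ =
  binarize T , ↭-reflexive (bleaves-binarize T) ,
  λ y y∈I cousins → P , matched-binarize (ψ ∘ lookup y) (scope-injective y y∈I) T T! cousins , fP≡1
  where
  open Binarization P P-leaves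

  scope-injective : ∀ y → IsConstraint I y → Injective _≡_ _≡_ (ψ ∘ lookup y)
  scope-injective y (_ , y∈I) e = All.lookup (Instance.distinct I) y∈I _ _ (ψ-injective e)
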